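{- For all $i=2,3,\ldots$ it holds that $f_i(R)\le w(L_i)-w(L_{i-1})$.
   Context: $\mathcal{G}=(R\cup B,E)$ is a simple bipartite graph without isolated nodes (nodes in $R$ red, in $B$ blue); each node has a strict linear order (preference) on its neighbours. Consider the following synchronous distributed algorithm run in rounds $1,2,\dots$, each round being a blue turn followed by a red turn (messages sent in a turn are received in the next turn). Each blue $b$ keeps $p(b)$, initially $\bot$. Each red $r$ keeps a list $C(r)$, initially all neighbours of $r$ in decreasing preference, and $c(r)=\bot$, $p(r)=\bot$. Blue turn, for each $b$: let $P$ be the set of neighbours that sent `propose'; if $P=\emptyset$ do nothing; else let $Q=P\cup\{p(b)\}$ if $p(b)\ne\bot$ and $Q=P$ otherwise, let $q$ be $b$'s most preferred node in $Q$; if $q\ne p(b)$ then send `break' to $p(b)$ (if $p(b)\neq\bot$), send `accept' to $q$ and set $p(b)\gets q$; send `reject' to every $r\in P\setminus\{q\}$. Red turn, for each $r$: (1) if $c(r)\ne\bot$: receive message $m$ from $c(r)$; if $m$=`accept' set $p(r)\gets c(r)$; if $m$=`reject' remove $c(r)$ from $C(r)$; set $c(r)\gets\bot$. (2) if $p(r)\ne\bot$ and $r$ receives `break' from $p(r)$: remove $p(r)$ from $C(r)$ and set $p(r)\gets\bot$. (3) if $p(r)=\bot$ and $C(r)\ne\emptyset$: set $c(r)$ to the first element of $C(r)$ and send `propose' to it. A subscript $i$ denotes the value of a variable at the end of round $i$. An edge $\{r,b\}$ ($r\in R$, $b\in B$) is lost by the end of round $i$ if $b$ was removed from $C(r)$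 in one of rounds $1,\dots,i$; $L_i\subseteq E$ is the set of such edges. Let $w:E\to\mathbb{Z}_{>0}$ be weights respecting preferences: whenever a node $v$ prefers $x$ over $y$, $w(\{v,x\})\ge w(\{v,y\})$; for $S\subseteq E$, $w(S)=\sum_{e\in S}w(e)$. For $r\in R$, the potential $f_i(r)$ is $0$ if $p_i(r)\ne\bot$ or $C_i(r)$ is empty, and otherwise $f_i(r)=w(\{r,b\})$ where $b$ is the first element of $C_i(r)$; $f_i(R)=\sum_{r\in R}f_i(r)$. -}

module Defs where

open import Data.Nat using (ℕ; zero; suc; _<_)
open import Data.Fin using (Fin; _≟_)
open import Data.List using (List; []; _∷_; _++_; map; filterᵇ; allFin; head; null)
open import Data.Nat.ListAction using (sum)
open import Data.Bool.ListAction using (any)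
open import Data.List.Relation.Unary.Unique.Propositional using (Unique)
open import Data.List.Membership.Propositional using (_∈_)
open import Data.Maybe using (Maybe; just; nothing)
open import Data.Bool using (Bool; true; false; if_then_else_; _∧_; not; _∨_)
open import Data.Product using (∃-syntax; _×_)
open import Relation.Nullary.Decidable using (⌊_⌋)
open import Relation.Binary.PropositionalEquality using (_≡_; _≢_)

-- Preferences as lists in decreasing order of preference.
-- `Before l x y` : x occurs strictly before y in l, i.e. x is preferred over y.

Before : {A : Set} → List A → A → A → Set
Before l x y = ∃[ xs ] ∃[ ys ] ∃[ zs ] (l ≡ xs ++ (x ∷ (ys ++ (y ∷ zs))))

-- A simple bipartite graph (R = Fin nR red, B = Fin nB blue) without
-- isolated nodes, with a strict linear preference order of every node on
-- its neighbours, given as the list of its neighbours (each exactly once)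
-- in decreasing preference.  {r,b} ∈ E  iff  b ∈ prefR r  iff  r ∈ prefB b.

record Instance (nR nB : ℕ) : Set where
  field
    prefR   : Fin nR → List (Fin nB)
    prefB   : Fin nB → List (Fin nR)
    uniqR   : ∀ r → Unique (prefR r)
    uniqB   : ∀ b → Unique (prefB b)
    symRB   : ∀ r b → b ∈ prefR r → r ∈ prefB b
    symBR   : ∀ r b → r ∈ prefB b → b ∈ prefR r
    noIsoR  : ∀ r → prefR r ≢ []
    noIsoB  : ∀ b → prefB b ≢ []

open Instance public

-- weights on E (given on all pairs, only edge values matter)
Weight : ℕ → ℕ → Set
Weight nR nB = Fin nR → Fin nB → ℕ

PositiveOnEdges : ∀ {nR nB} → Instance nR nB → Weight nR nB → Set
PositiveOnEdges G w = ∀ r b → b ∈ prefR G r → 0 < w r b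

RespectsPrefs : ∀ {nR nB} → Instance nR nB → Weight nR nB → Set
RespectsPrefs G w =
  (∀ r x y → Before (prefR G r) x y → w r y Data.Nat.≤ w r x) ×
  (∀ b x y → Before (prefB G b) x y → w y b Data.Nat.≤ w x b)

_==_ : ∀ {n} → Fin n → Fin n → Bool
x == y = ⌊ x ≟ y ⌋

_=?M_ : ∀ {n} → Maybe (Fin n) → Fin n → Bool
just x  =?M y = x == y
nothing =?M y = false

_∈ᵇ_ : ∀ {n} → Fin n → List (Fin n) → Bool
x ∈ᵇ l = any (_== x) l

remove : ∀ {n} → Fin n → List (Fin n) → List (Fin n)
remove x l = filterᵇ (λ y → not (y == x)) l

-- Global state at the end of a round.
--   pB b   : p(b)
--   C r    : C(r)
--   c r    : c(r)   (c(r) = just b at the end of a red turn iff r sent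
--                     `propose' to b in that turn)
--   pR r   : p(r)
--   lost r : log of all b that have been removed from C(r) so far

record State (nR nB : ℕ) : Set where
  field
    pB   : Fin nB → Maybe (Fin nR)
    C    : Fin nR → List (Fin nB)
    c    : Fin nR → Maybe (Fin nB)
    pR   : Fin nR → Maybe (Fin nB)
    lost : Fin nR → List (Fin nB)

open State public

-- what a blue node does in its turn: new p(b) and the messages it sends
record BlueOut (nR : ℕ) : Set where
  constructor bout
  field
    newP : Maybe (Fin nR)
    acc  : Fin nR → Bool
    rej  : Fin nR → Bool
    brk  : Fin nR → Bool

open BlueOut public

record RedSt (nB : ℕ) : Set where
  constructor rst
  field
    rC    : List (Fin nB)
    rc    : Maybe (Fin nB)
    rp    : Maybe (Fin nB)
    rlost : List (Fin nB)

open RedSt public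

module Algorithm {nR nB : ℕ} (G : Instance nR nB) where

  initial : State nR nB
  initial = record
    { pB = λ _ → nothing ; C = prefR G ; c = λ _ → nothing
    ; pR = λ _ → nothing ; lost = λ _ → [] }

  proposers : State nR nB → Fin nB → List (Fin nR)
  proposers s b = filterᵇ (λ r → c s r =?M b) (allFin nR)

  best : Fin nB → (Fin nR → Bool) → Maybe (Fin nR)
  best b inQ = head (filterᵇ inQ (prefB G b))

  silent : Maybe (Fin nR) → BlueOut nR
  silent p = bout p (λ _ → false) (λ _ → false) (λ _ → false)

  blueTurn : State nR nB → Fin nB → BlueOut nR
  blueTurn s b with null (proposers s b)
  ... | true  = silent (pB s b)
  ... | false with best b (λ r → (r ∈ᵇ proposers s b) ∨ (pB s b =?M r))
  ...   | nothing = silent (pB s b)   -- cannot happen (Q ⊆ neighbours of b)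
  ...   | just q with pB s b =?M q
  ...     | true  = bout (pB s b) (λ _ → false) rejs (λ _ → false)
    where rejs = λ r → (r ∈ᵇ proposers s b) ∧ not (r == q)
  ...     | false = bout (just q) (λ r → r == q) rejs (λ r → pB s b =?M r)
    where rejs = λ r → (r ∈ᵇ proposers s b) ∧ not (r == q)

  redStep1 : (Fin nB → BlueOut nR) → Fin nR → RedSt nB → RedSt nB
  redStep1 out r (rst C' nothing p l) = rst C' nothing p l
  redStep1 out r (rst C' (just b) p l) =
    if acc (out b) r then rst C' nothing (just b) l
    else if rej (out b) r then rst (remove b C') nothing p (b ∷ l)
    else rst C' nothing p l

  redStep2 : (Fin nB → BlueOut nR) → Fin nR → RedSt nB → RedSt nB
  redStep2 out r (rst C' c' nothing l) = rst C' c' nothing l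
  redStep2 out r (rst C' c' (just b) l) =
    if brk (out b) r then rst (remove b C') c' nothing (b ∷ l)
    else rst C' c' (just b) l

  redStep3 : RedSt nB → RedSt nB
  redStep3 (rst [] c' nothing l)        = rst [] c' nothing l
  redStep3 (rst (b ∷ C') c' nothing l)  = rst (b ∷ C') (just b) nothing l
  redStep3 (rst C' c' (just p) l)       = rst C' c' (just p) l

  redTurn : State nR nB → (Fin nB → BlueOut nR) → Fin nR → RedSt nB
  redTurn s out r =
    redStep3 (redStep2 out r (redStep1 out r (rst (C s r) (c s r) (pR s r) (lost s r))))

  round : State nR nB → State nR nB
  round s = record
    { pB   = λ b → newP (out b)
    ; C    = λ r → rC (redTurn s out r)
    ; c    = λ r → rc (redTurn s out r)
    ; pR   = λ r → rp (redTurn s out r)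
    ; lost = λ r → rlost (redTurn s out r) }
    where out = blueTurn s

  state : ℕ → State nR nB
  state zero    = initial
  state (suc i) = round (state i)

  -- w(L_i): sum of w over edges {r,b} such that b was removed from C(r)
  -- in one of the rounds 1..i
  wL : Weight nR nB → ℕ → ℕ
  wL w i = sum (map (λ r → sum (map (w r)
             (filterᵇ (λ b → b ∈ᵇ lost (state i) r) (prefR G r)))) (allFin nR))

  f : Weight nR nB → ℕ → Fin nR → ℕ
  f w i r with pR (state i) r | C (state i) r
  ... | just _  | _     = 0
  ... | nothing | []    = 0
  ... | nothing | b ∷ _ = w r b

  fR : Weight nR nB → ℕ → ℕ
  fR w i = sum (map (f w i) (allFin nR))

module Submission where

-- Invariants (`Consistent`, by induction over the rounds): C(r) is the list of
-- neighbours of r not lost yet, in order of preference; a partner or proposal of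
-- r is the head of C(r) (`Phase`); partnerships are mutual.  After round 1, an
-- idle red node has an empty list (`Settled`), and blue nodes answer every
-- proposal, since a proposer is never their partner (`blue-answers`).
--
-- Accounting (`turn-account`): in round i ≥ 2, a red node ends up engaged
-- (f_i(r) = 0), exhausted (f_i(r) = 0), or has lost its top candidate b in this
-- round.  In the last case its new top candidate is less preferred than b, so
-- f_i(r) ≤ w(r,b), while w(r,b) was added to its lost weight.  Summing over all
-- red nodes gives f_i(R) + w(L_{i-1}) ≤ w(L_i) (`weight-balance`).

open import Defs
open import Data.Nat using (ℕ; zero; suc; _+_; _≤_; _∸_; s≤s)
open import Data.Nat.Properties
  using (≤-refl; ≤-trans; +-mono-≤; +-monoʳ-≤; +-monoˡ-≤; m≤m+n; m≤n+m; m+n≤o⇒m≤o∸n;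
         +-comm; +-assoc; +-commutativeSemigroup; module ≤-Reasoning)
open import Algebra.Properties.CommutativeSemigroup +-commutativeSemigroup using (interchange)
open import Data.Integer using (+_; _-_; +≤+) renaming (_≤_ to _≤ℤ_)
open import Data.Integer.Properties using (m-n≡m⊖n; ⊖-≥)
open import Data.Fin using (Fin; _≟_)
open import Data.List using (List; []; _∷_; map; filterᵇ; allFin; null)
open import Data.Nat.ListAction using (sum)
open import Data.List.Properties using (filter-all)
open import Data.List.Relation.Unary.All using (universal)
open import Data.List.Relation.Unary.Any using (here; there)
import Data.List.Relation.Unary.Any as Any
open import Data.List.Relation.Unary.Any.Properties using (any⁺; any⁻)
open import Data.List.Membership.Propositional using (_∈_)
open import Data.List.Membership.Propositional.Properties using (∈-filter⁺; ∈-filter⁻; ∈-allFin; ∈-∃++)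
open import Data.Maybe using (Maybe; just; nothing)
open import Data.Bool using (Bool; true; false; T; not; _∨_)
open import Data.Bool.Properties using (T-∨; T-∧; ∨-zeroʳ)
open import Data.Unit using (tt)
open import Data.Product using (_×_; _,_; proj₁; proj₂)
open import Data.Sum using (_⊎_; inj₁; inj₂)
open import Data.Empty using (⊥-elim)
open import Function using (_∘_; Equivalence)
open import Relation.Nullary using (yes; no)
open import Relation.Nullary.Decidable using (T?; toWitness; fromWitness; toWitnessFalse; fromWitnessFalse)
open import Relation.Binary.PropositionalEquality using (_≡_; _≢_; refl; sym; trans; cong; subst)

==-sound : ∀ {n} {x y : Fin n} → T (x == y) → x ≡ y
==-sound = toWitness

==-refl : ∀ {n} (x : Fin n) → T (x == x)
==-refl x = fromWitness refl

-- `∈ᵇ` and `remove` compare in opposite orders, so symmetry is needed.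
==-sym : ∀ {n} (x y : Fin n) → (x == y) ≡ (y == x)
==-sym x y with x ≟ y | y ≟ x
... | yes _ | yes _ = refl
... | no  _ | no  _ = refl
... | yes x≡y | no y≢x = ⊥-elim (y≢x (sym x≡y))
... | no x≢y | yes y≡x = ⊥-elim (x≢y (sym y≡x))

=?M-sound : ∀ {n} (m : Maybe (Fin n)) q → (m =?M q) ≡ true → m ≡ just q
=?M-sound (just x) q x==q = cong just (==-sound (subst T (sym x==q) tt))

∈ᵇ-sound : ∀ {n} {x : Fin n} {l} → T (x ∈ᵇ l) → x ∈ l
∈ᵇ-sound {l = l} t = Any.map (sym ∘ ==-sound) (any⁻ _ l t)

∈ᵇ-complete : ∀ {n} {x : Fin n} {l} → x ∈ l → T (x ∈ᵇ l)
∈ᵇ-complete x∈l = any⁺ _ (Any.map (λ { refl → ==-refl _ }) x∈l)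

remove-unlisted : ∀ {n} (b : Fin n) ls xs →
  remove b (filterᵇ (λ y → not (y ∈ᵇ ls)) xs) ≡ filterᵇ (λ y → not (y ∈ᵇ (b ∷ ls))) xs
remove-unlisted b ls [] = refl
remove-unlisted b ls (y ∷ xs) with y ∈ᵇ ls
... | true rewrite ∨-zeroʳ (b == y) = remove-unlisted b ls xs
remove-unlisted b ls (y ∷ xs) | false with b == y | y == b | ==-sym b y
...   | true  | true  | refl = remove-unlisted b ls xs
...   | false | false | refl = cong (y ∷_) (remove-unlisted b ls xs)

remove-top : ∀ {n} (b : Fin n) rest {x} → x ∈ remove b (b ∷ rest) → x ∈ rest
remove-top b rest x∈ with ∈-filter⁻ (T? ∘ λ y → not (y == b)) {xs = b ∷ rest} x∈
... | here refl   , x≢b = ⊥-elim (toWitnessFalse x≢b refl)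
... | there x∈rest , _ = x∈rest

∈⇒nonnull : ∀ {A : Set} {x : A} {l} → x ∈ l → null l ≡ false
∈⇒nonnull (here _)  = refl
∈⇒nonnull (there _) = refl

first-before : ∀ {A : Set} (P : A → Bool) l {y rest x} →
  filterᵇ P l ≡ y ∷ rest → x ∈ rest → Before l y x
first-before P (z ∷ l) eq x∈rest with P z
first-before P (z ∷ l) refl x∈rest | true with ∈-∃++ (proj₁ (∈-filter⁻ (T? ∘ P) {xs = l} x∈rest))
... | ys , zs , refl = [] , ys , zs , refl
first-before P (z ∷ l) eq x∈rest | false with first-before P l eq x∈rest
... | xs , ys , zs , refl = z ∷ xs , ys , zs , refl

filteredSum : ∀ {A : Set} → (A → ℕ) → (A → Bool) → List A → ℕ
filteredSum g P xs = sum (map g (filterᵇ P xs))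

filteredSum-mono : ∀ {A : Set} (g : A → ℕ) (P Q : A → Bool) xs →
  (∀ y → T (P y) → T (Q y)) → filteredSum g P xs ≤ filteredSum g Q xs
filteredSum-mono g P Q [] P⊆Q = ≤-refl
filteredSum-mono g P Q (y ∷ xs) P⊆Q with P y | Q y | P⊆Q y
... | true  | true  | _    = +-monoʳ-≤ (g y) (filteredSum-mono g P Q xs P⊆Q)
... | true  | false | Py⇒Qy = ⊥-elim (Py⇒Qy tt)
... | false | true  | _    = ≤-trans (filteredSum-mono g P Q xs P⊆Q) (m≤n+m _ (g y))
... | false | false | _    = filteredSum-mono g P Q xs P⊆Q

filteredSum-gain : ∀ {A : Set} (g : A → ℕ) (P Q : A → Bool) xs {b} → b ∈ xs →
  T (not (P b)) → T (Q b) → (∀ y → T (P y) → T (Q y)) →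
  filteredSum g P xs + g b ≤ filteredSum g Q xs
filteredSum-gain g P Q (y ∷ xs) (here refl) ¬Pb Qb P⊆Q with P y | Q y
... | true  | _     = ⊥-elim ¬Pb
... | false | false = ⊥-elim Qb
... | false | true  = subst (_≤ g y + filteredSum g Q xs) (+-comm (g y) _)
                        (+-monoʳ-≤ (g y) (filteredSum-mono g P Q xs P⊆Q))
filteredSum-gain g P Q (y ∷ xs) (there b∈xs) ¬Pb Qb P⊆Q with P y | Q y | P⊆Q y
... | true  | true  | _ = subst (_≤ g y + filteredSum g Q xs) (sym (+-assoc (g y) _ _))
                            (+-monoʳ-≤ (g y) (filteredSum-gain g P Q xs b∈xs ¬Pb Qb P⊆Q))
... | true  | false | Py⇒Qy = ⊥-elim (Py⇒Qy tt)
... | false | true  | _ = ≤-trans (filteredSum-gain g P Q xs b∈xs ¬Pb Qb P⊆Q) (m≤n+m _ (g y))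
... | false | false | _ = filteredSum-gain g P Q xs b∈xs ¬Pb Qb P⊆Q

sum-pointwise : ∀ {A : Set} (f g h : A → ℕ) xs → (∀ x → f x + g x ≤ h x) →
  sum (map f xs) + sum (map g xs) ≤ sum (map h xs)
sum-pointwise f g h [] fg≤h = ≤-refl
sum-pointwise f g h (x ∷ xs) fg≤h =
  subst (_≤ h x + sum (map h xs)) (interchange (f x) (g x) (sum (map f xs)) (sum (map g xs)))
    (+-mono-≤ (fg≤h x) (sum-pointwise f g h xs fg≤h))

≤-minus : ∀ a b c → a + b ≤ c → + a ≤ℤ + c - + b
≤-minus a b c a+b≤c rewrite m-n≡m⊖n c b | ⊖-≥ (≤-trans (m≤n+m b a) a+b≤c) =
  +≤+ (m+n≤o⇒m≤o∸n a a+b≤c)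

module Analysis {nR nB : ℕ} (G : Instance nR nB) where
  open Algorithm G

  candidates : Fin nR → List (Fin nB) → List (Fin nB)
  candidates r ls = filterᵇ (λ b → not (b ∈ᵇ ls)) (prefR G r)

  top-candidate : ∀ r ls {b rest} → b ∷ rest ≡ candidates r ls → b ∈ prefR G r × T (not (b ∈ᵇ ls))
  top-candidate r ls {b} C-def = ∈-filter⁻ (T? ∘ _) {xs = prefR G r} (subst (b ∈_) C-def (here refl))

  contenders : State nR nB → Fin nB → Fin nR → Bool
  contenders s b r = (r ∈ᵇ proposers s b) ∨ (pB s b =?M r)

  redState : State nR nB → Fin nR → RedSt nB
  redState s r = rst (C s r) (c s r) (pR s r) (lost s r)

  turn : (Fin nB → BlueOut nR) → Fin nR → RedSt nB → RedSt nB
  turn out r st = redStep3 (redStep2 out r (redStep1 out r st))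

  data Phase : Maybe (Fin nB) → Maybe (Fin nB) → List (Fin nB) → Set where
    idle      : ∀ {Cs} → Phase nothing nothing Cs
    engaged   : ∀ {b Cs} → Phase nothing (just b) (b ∷ Cs)
    proposing : ∀ {b Cs} → Phase (just b) nothing (b ∷ Cs)

  record RedInv (r : Fin nR) (st : RedSt nB) : Set where
    constructor redInv
    field
      C-def : rC st ≡ candidates r (rlost st)
      phase : Phase (rc st) (rp st) (rC st)
  open RedInv

  Settled : RedSt nB → Set
  Settled st = rc st ≡ nothing → rp st ≡ nothing → rC st ≡ []

  propose-step : ∀ r Cs ls → Cs ≡ candidates r ls →
    RedInv r (redStep3 (rst Cs nothing nothing ls)) × Settled (redStep3 (rst Cs nothing nothing ls))
  propose-step r []      ls C-def = redInv C-def idle , λ _ _ → refl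
  propose-step r (b ∷ _) ls C-def = redInv C-def proposing , λ ()

  lose-step : ∀ r Cs ls b → Cs ≡ candidates r ls →
    RedInv r (redStep3 (rst (remove b Cs) nothing nothing (b ∷ ls))) ×
    Settled (redStep3 (rst (remove b Cs) nothing nothing (b ∷ ls)))
  lose-step r Cs ls b C-def =
    propose-step r (remove b Cs) (b ∷ ls) (trans (cong (remove b) C-def) (remove-unlisted b ls (prefR G r)))

  turn-inv : ∀ out r {Cs cs ps ls} → RedInv r (rst Cs cs ps ls) →
    RedInv r (turn out r (rst Cs cs ps ls)) × Settled (turn out r (rst Cs cs ps ls))
  turn-inv out r {Cs} {ls = ls} (redInv C-def idle) = propose-step r Cs ls C-def
  turn-inv out r {Cs} {ls = ls} (redInv C-def (engaged {b})) with brk (out b) r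
  ... | true  = lose-step r Cs ls b C-def
  ... | false = redInv C-def engaged , λ _ ()
  turn-inv out r {Cs} {ls = ls} (redInv C-def (proposing {b})) with acc (out b) r
  ... | true with brk (out b) r
  ...   | true  = lose-step r Cs ls b C-def
  ...   | false = redInv C-def engaged , λ _ ()
  turn-inv out r {Cs} {ls = ls} (redInv C-def (proposing {b})) | false with rej (out b) r
  ...   | true  = lose-step r Cs ls b C-def
  ...   | false = propose-step r Cs ls C-def

  stays-engaged : ∀ out r {Cs cs ps ls b} → Phase cs ps Cs → ps ≡ just b →
    brk (out b) r ≡ false → rp (turn out r (rst Cs cs ps ls)) ≡ just b
  stays-engaged out r engaged refl no-break rewrite no-break = refl

  becomes-engaged : ∀ out r {Cs cs ps ls b} → Phase cs ps Cs → cs ≡ just b →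
    T (acc (out b) r) → brk (out b) r ≡ false → rp (turn out r (rst Cs cs ps ls)) ≡ just b
  becomes-engaged out r (proposing {b}) refl accepted no-break with acc (out b) r
  ... | true rewrite no-break = refl

  proposal-facts : ∀ {r Cs cs ps ls b} → RedInv r (rst Cs cs ps ls) → cs ≡ just b →
    ps ≡ nothing × b ∈ prefR G r
  proposal-facts {r} {ls = ls} (redInv C-def proposing) refl = refl , proj₁ (top-candidate r ls C-def)

  proposer⁺ : ∀ s b r → c s r ≡ just b → T (r ∈ᵇ proposers s b)
  proposer⁺ s b r proposed = ∈ᵇ-complete (∈-filter⁺ (T? ∘ _) (∈-allFin r) to-b)
    where
    to-b : T (c s r =?M b)
    to-b rewrite proposed = ==-refl b

  proposer⁻ : ∀ s b r → T (r ∈ᵇ proposers s b) → c s r ≡ just b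
  proposer⁻ s b r r∈P with c s r | proj₂ (∈-filter⁻ (T? ∘ _) {xs = allFin nR} (∈ᵇ-sound r∈P))
  ... | just b' | b'==b = cong just (==-sound b'==b)

  -- b accepts or rejects every proposal of a neighbour r without partner: the
  -- only node b may stay silent to is its own partner, whose partner is b.
  blue-answers : ∀ s b r → c s r ≡ just b → pR s r ≡ nothing → r ∈ prefB G b →
    (∀ r' → pB s b ≡ just r' → pR s r' ≡ just b) →
    T (acc (blueTurn s b) r ∨ rej (blueTurn s b) r)
  blue-answers s b r proposed free r∈b matched
    with null (proposers s b) | ∈⇒nonnull (∈ᵇ-sound {l = proposers s b} (proposer⁺ s b r proposed))
  ... | false | _ with filterᵇ (contenders s b) (prefB G b) | ∈-filter⁺ (T? ∘ contenders s b) r∈b r-contends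
    where
    r-contends : T (contenders s b r)
    r-contends = Equivalence.from T-∨ (inj₁ (proposer⁺ s b r proposed))
  ...   | q ∷ _ | _ with pB s b =?M q in current
  ...     | true  = Equivalence.from T-∧ (proposer⁺ s b r proposed , fromWitnessFalse r≢q)
    where
    r≢q : r ≢ q
    r≢q refl with trans (sym (matched r (=?M-sound (pB s b) r current))) free
    ... | ()
  ...     | false with r ≟ q
  ...       | yes refl = tt
  ...       | no _     = Equivalence.from T-∧ (proposer⁺ s b r proposed , tt)

  new-partner : ∀ s b r → newP (blueTurn s b) ≡ just r →
    (pB s b ≡ just r × brk (blueTurn s b) r ≡ false) ⊎
    (c s r ≡ just b × T (acc (blueTurn s b) r) × brk (blueTurn s b) r ≡ false)
  new-partner s b r chosen with null (proposers s b)
  ... | true  = inj₁ (chosen , refl)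
  ... | false with filterᵇ (contenders s b) (prefB G b) in first
  ...   | []    = inj₁ (chosen , refl)
  ...   | q ∷ _ with pB s b =?M q in current
  ...     | true  = inj₁ (chosen , refl)
  ...     | false with chosen
  ...       | refl = inj₂ (proposer⁻ s b q q-proposed , ==-refl q , current)
    where
    q-contends : T (contenders s b q)
    q-contends = proj₂ (∈-filter⁻ (T? ∘ _) {xs = prefB G b} (subst (q ∈_) (sym first) (here refl)))
    q-proposed : T (q ∈ᵇ proposers s b)
    q-proposed with Equivalence.to T-∨ q-contends
    ... | inj₁ proposed = proposed
    ... | inj₂ was-partner rewrite current = ⊥-elim was-partner

  record Consistent (s : State nR nB) : Set where
    field
      reds    : ∀ r → RedInv r (redState s r)
      matched : ∀ b r → pB s b ≡ just r → pR s r ≡ just b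
  open Consistent

  all-candidates : ∀ r → prefR G r ≡ candidates r []
  all-candidates r = sym (filter-all (T? ∘ _) (universal (λ _ → tt) (prefR G r)))

  matched-step : ∀ s → Consistent s → ∀ b r →
    pB (round s) b ≡ just r → pR (round s) r ≡ just b
  matched-step s inv b r chosen with new-partner s b r chosen
  ... | inj₁ (old , no-break) =
    stays-engaged (blueTurn s) r (phase (reds inv r)) (matched inv b r old) no-break
  ... | inj₂ (proposed , accepted , no-break) =
    becomes-engaged (blueTurn s) r (phase (reds inv r)) proposed accepted no-break

  consistent : ∀ n → Consistent (state n)
  consistent zero = record
    { reds    = λ r → redInv (all-candidates r) idle
    ; matched = λ _ _ () }
  consistent (suc n) = record
    { reds    = λ r → proj₁ (turn-inv (blueTurn (state n)) r (reds (consistent n) r))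
    ; matched = matched-step (state n) (consistent n) }

  settled : ∀ n r → Settled (redState (state (suc n)) r)
  settled n r = proj₂ (turn-inv (blueTurn (state n)) r (reds (consistent n) r))

  answered : ∀ n r b → c (state n) r ≡ just b →
    T (acc (blueTurn (state n) b) r ∨ rej (blueTurn (state n) b) r)
  answered n r b proposed with proposal-facts (reds (consistent n) r) proposed
  ... | free , b∈r = blue-answers (state n) b r proposed free (symRB G r b b∈r) (matched (consistent n) b)

  module Accounting (w : Weight nR nB)
                    (prefers : ∀ r x y → Before (prefR G r) x y → w r y ≤ w r x) where

    lostWeight : Fin nR → List (Fin nB) → ℕ
    lostWeight r ls = filteredSum (w r) (λ b → b ∈ᵇ ls) (prefR G r)

    potential : Fin nR → RedSt nB → ℕ
    potential r (rst _       _ (just _) _) = 0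
    potential r (rst []      _ nothing  _) = 0
    potential r (rst (b ∷ _) _ nothing  _) = w r b

    f-potential : ∀ i r → f w i r ≡ potential r (redState (state i) r)
    f-potential i r with pR (state i) r | C (state i) r
    ... | just _  | _     = refl
    ... | nothing | []    = refl
    ... | nothing | _ ∷ _ = refl

    lost-weight-gain : ∀ r ls {b rest} → b ∷ rest ≡ candidates r ls →
      lostWeight r ls + w r b ≤ lostWeight r (b ∷ ls)
    lost-weight-gain r ls {b} C-def with top-candidate r ls C-def
    ... | b∈r , b-not-lost = filteredSum-gain (w r) _ _ (prefR G r) b∈r b-not-lost
      (Equivalence.from T-∨ (inj₁ (==-refl b))) (λ _ → Equivalence.from T-∨ ∘ inj₂)

    later-candidate : ∀ r ls {b rest x} → b ∷ rest ≡ candidates r ls → x ∈ rest → w r x ≤ w r b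
    later-candidate r ls C-def x∈rest = prefers r _ _ (first-before _ (prefR G r) (sym C-def) x∈rest)

    loss-account : ∀ r ls b rest → b ∷ rest ≡ candidates r ls →
      potential r (redStep3 (rst (remove b (b ∷ rest)) nothing nothing (b ∷ ls))) + lostWeight r ls
        ≤ lostWeight r (rlost (redStep3 (rst (remove b (b ∷ rest)) nothing nothing (b ∷ ls))))
    loss-account r ls b rest C-def = after (remove b (b ∷ rest)) (remove-top b rest)
      where
      open ≤-Reasoning
      after : ∀ L → (∀ {x} → x ∈ L → x ∈ rest) →
        potential r (redStep3 (rst L nothing nothing (b ∷ ls))) + lostWeight r ls
          ≤ lostWeight r (rlost (redStep3 (rst L nothing nothing (b ∷ ls))))
      after []      _ = ≤-trans (m≤m+n _ (w r b)) (lost-weight-gain r ls C-def)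
      after (x ∷ _) L⊆rest = begin
        w r x + lostWeight r ls  ≤⟨ +-monoˡ-≤ _ (later-candidate r ls C-def (L⊆rest (here refl))) ⟩
        w r b + lostWeight r ls  ≡⟨ +-comm (w r b) _ ⟩
        lostWeight r ls + w r b  ≤⟨ lost-weight-gain r ls C-def ⟩
        lostWeight r (b ∷ ls)    ∎

    turn-account : ∀ out r {Cs cs ps ls} → RedInv r (rst Cs cs ps ls) → Settled (rst Cs cs ps ls) →
      (∀ b → cs ≡ just b → T (acc (out b) r ∨ rej (out b) r)) →
      potential r (turn out r (rst Cs cs ps ls)) + lostWeight r ls
        ≤ lostWeight r (rlost (turn out r (rst Cs cs ps ls)))
    turn-account out r (redInv _ idle) exhausted _ with exhausted refl refl
    ... | refl = ≤-refl
    turn-account out r {ls = ls} (redInv C-def (engaged {b} {rest})) _ _ with brk (out b) r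
    ... | true  = loss-account r ls b rest C-def
    ... | false = ≤-refl
    turn-account out r {ls = ls} (redInv C-def (proposing {b} {rest})) _ answer
      with acc (out b) r | rej (out b) r | answer b refl
    ... | true  | _     | _ with brk (out b) r
    ...   | true  = loss-account r ls b rest C-def
    ...   | false = ≤-refl
    turn-account out r {ls = ls} (redInv C-def (proposing {b} {rest})) _ answer
        | false | true  | _ = loss-account r ls b rest C-def
    turn-account out r (redInv _ proposing) _ answer | false | false | ()

    red-balance : ∀ k r →
      f w (suc (suc k)) r + lostWeight r (lost (state (suc k)) r) ≤ lostWeight r (lost (state (suc (suc k))) r)
    red-balance k r rewrite f-potential (suc (suc k)) r =
      turn-account (blueTurn (state (suc k))) r (reds (consistent (suc k)) r) (settled k r) (answered (suc k) r)

    weight-balance : ∀ k → fR w (suc (suc k)) + wL w (suc k) ≤ wL w (suc (suc k))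
    weight-balance k = sum-pointwise _ _ _ (allFin nR) (red-balance k)

lemma2 : ∀ {nR nB} (G : Instance nR nB) (w : Weight nR nB) → PositiveOnEdges G w → RespectsPrefs G w → (i : ℕ) → 2 ≤ i → (+ Algorithm.fR G w i) ≤ℤ ((+ Algorithm.wL G w i) - (+ Algorithm.wL G w (i ∸ 1)))
lemma2 G w _ respects zero          ()
lemma2 G w _ respects (suc zero)    (s≤s ())
lemma2 G w _ respects (suc (suc k)) _ = ≤-minus _ _ _ (weight-balance k)
  where open Analysis.Accounting G w (proj₁ respects)
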